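{- Let $a,b\ge 0$ be integers with $a\ge b$ and $a+b=N/4$, and consider the $4\times N$ partial Hadamard matrix $H=(\underbrace{W_4\ \cdots\ W_4}_{a}\ \underbrace{K_4\ \cdots\ K_4}_{b})$. If $H$ completes into a $5\times N$ partial Hadamard matrix (i.e. there is a row vector $x\in\{\pm1\}^N$ such that the matrix obtained by appending $x$ as a fifth row to $H$ is a partial Hadamard matrix), then $ab=0$ implies $N\equiv 0\pmod 8$. In particular, the $4\times 12$ partial Hadamard matrix $(W_4\ W_4\ W_4)$ does not complete into a $5\times 12$ partial Hadamard matrix.
   Context: A partial Hadamard matrix is a matrix in $M_{M\times N}(\pm1)$ whose rows are pairwise orthogonal in $\mathbb{R}^N$. Here $W_4=\begin{pmatrix}1&1&1&1\\1&-1&1&-1\\1&1&-1&-1\\1&-1&-1&1\end{pmatrix}$ and $K_4=\begin{pmatrix}-1&1&1&1\\1&-1&1&1\\1&1&-1&1\\1&1&1&-1\end{pmatrix}$; the matrix $H$ is the horizontal concatenation of $a$ copies of $W_4$ followed by $b$ copies of $K_4$. -}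

module Defs where

open import Data.Nat using (ℕ; zero; suc; _<ᵇ_; _*_)
open import Data.Nat.DivMod using (_mod_)
open import Data.Bool using (if_then_else_)
open import Data.Integer using (ℤ; 1ℤ; -1ℤ; 0ℤ; _+_) renaming (_*_ to _*ℤ_)
open import Data.Fin using (Fin; zero; suc; toℕ)
open import Data.Sum using (_⊎_)
open import Data.Product using (_×_)
open import Data.Nat using (_≟_)
open import Relation.Nullary using (yes; no)
open import Relation.Binary.PropositionalEquality using (_≡_)
open import Relation.Nullary using (¬_)

Matrix : ℕ → ℕ → Set
Matrix m n = Fin m → Fin n → ℤ

∑ : ∀ {n} → (Fin n → ℤ) → ℤ
∑ {zero}  f = 0ℤ
∑ {suc n} f = f zero + ∑ (λ i → f (suc i))

dot : ∀ {n} → (Fin n → ℤ) → (Fin n → ℤ) → ℤ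
dot u v = ∑ (λ k → u k *ℤ v k)

IsPartialHadamard : ∀ {m n} → Matrix m n → Set
IsPartialHadamard {m} {n} H =
  (∀ i j → (H i j ≡ 1ℤ) ⊎ (H i j ≡ -1ℤ)) ×
  (∀ (i i' : Fin m) → ¬ (i ≡ i') → dot (H i) (H i') ≡ 0ℤ)

appendRow : ∀ {m n} → Matrix m n → (Fin n → ℤ) → Matrix (suc m) n
appendRow {zero}  H x zero    = x
appendRow {zero}  H x (suc ())
appendRow {suc m} H x zero    = H zero
appendRow {suc m} H x (suc i) = appendRow (λ i' → H (suc i')) x i

W4 : Matrix 4 4
W4 zero                   j = 1ℤ
W4 (suc zero)             j = pat j
  where pat : Fin 4 → ℤ
        pat zero = 1ℤ ; pat (suc zero) = -1ℤ ; pat (suc (suc zero)) = 1ℤ ; pat (suc (suc (suc zero))) = -1ℤ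
W4 (suc (suc zero))       j = pat j
  where pat : Fin 4 → ℤ
        pat zero = 1ℤ ; pat (suc zero) = 1ℤ ; pat (suc (suc zero)) = -1ℤ ; pat (suc (suc (suc zero))) = -1ℤ
W4 (suc (suc (suc zero))) j = pat j
  where pat : Fin 4 → ℤ
        pat zero = 1ℤ ; pat (suc zero) = -1ℤ ; pat (suc (suc zero)) = -1ℤ ; pat (suc (suc (suc zero))) = 1ℤ

K4 : Matrix 4 4
K4 i j with toℕ i ≟ toℕ j
... | yes _ = -1ℤ
... | no  _ = 1ℤ

-- H = (W4 ... W4 K4 ... K4) with a copies of W4 followed by copies of K4
-- (column c, 0-based, lies in block c div 4, at local column c mod 4;
--  the first a blocks are W4, the remaining ones K4)
Hab : (a : ℕ) → ∀ {N} → Matrix 4 N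
Hab a i c =
  if toℕ c <ᵇ 4 * a then W4 i (toℕ c mod 4) else K4 i (toℕ c mod 4)

module Submission where

-- If a ≥ b and ab = 0 then b = 0, so H consists of
-- a copies of W₄ and N = 4a.  Let x be a ±1 row orthogonal to the four rows of
-- H.  Adding the four orthogonality relations gives  dot (colSum H) x = 0,
-- where colSum H is the vector of column sums of H.  A column of W₄ sums to 4
-- if it is the first column of the block and to 0 otherwise, so this says
-- 4 · (sum of the a entries x_c with c ≡ 0 mod 4) = 0.  A sum of a signs that
-- vanishes forces a to be even (the sum of a signs is a minus twice the number
-- of -1's), hence 8 ∣ 4a = N.

open import Defs
open import Data.Nat using (ℕ; zero; suc; _≥_; _+_; _*_; _%_; _<ᵇ_; z≤n; s≤s)
open import Data.Nat.Properties using (<⇒<ᵇ; *-suc; +-comm; +-identityʳ)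
open import Data.Nat.DivMod using (_mod_; [m+n]%n≡m%n; m%n<n)
open import Data.Nat.Divisibility using (_∣_; divides; _∣?_; *-monoʳ-∣)
open import Data.Nat.Tactic.RingSolver as ℕ-Solver using ()
open import Data.Integer using (ℤ; +_; -[1+_]; 0ℤ; 1ℤ; -1ℤ)
  renaming (_+_ to _+ℤ_; _*_ to _*ℤ_; _-_ to _-ℤ_)
open import Data.Integer.Properties as ℤ using ()
open import Data.Integer.Tactic.RingSolver using (solve-∀)
open import Data.Fin using (Fin; zero; suc; toℕ)
open import Data.Fin.Properties using (toℕ<n; toℕ-fromℕ<)
open import Data.Bool using (true; false)
open import Data.Product using (_×_; ∃; _,_; proj₁; proj₂)
open import Data.Sum using (_⊎_; inj₁; inj₂)
open import Relation.Nullary using (¬_)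
open import Relation.Nullary.Decidable using (toWitnessFalse)
open import Relation.Binary.PropositionalEquality
  using (_≡_; refl; sym; trans; cong; cong₂; module ≡-Reasoning)

open ≡-Reasoning

∑-cong : ∀ {n} {f g : Fin n → ℤ} → (∀ i → f i ≡ g i) → ∑ f ≡ ∑ g
∑-cong {zero}  p = refl
∑-cong {suc n} p = cong₂ _+ℤ_ (p zero) (∑-cong (λ i → p (suc i)))

∑-zero : ∀ {n} {f : Fin n → ℤ} → (∀ i → f i ≡ 0ℤ) → ∑ f ≡ 0ℤ
∑-zero {zero}  p = refl
∑-zero {suc n} p = cong₂ _+ℤ_ (p zero) (∑-zero (λ i → p (suc i)))

∑-+ : ∀ {n} (f g : Fin n → ℤ) → ∑ f +ℤ ∑ g ≡ ∑ (λ i → f i +ℤ g i)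
∑-+ {zero}  f g = refl
∑-+ {suc n} f g = begin
  (f zero +ℤ ∑ f′) +ℤ (g zero +ℤ ∑ g′) ≡⟨ interchange (f zero) (g zero) (∑ f′) (∑ g′) ⟩
  (f zero +ℤ g zero) +ℤ (∑ f′ +ℤ ∑ g′) ≡⟨ cong ((f zero +ℤ g zero) +ℤ_) (∑-+ f′ g′) ⟩
  (f zero +ℤ g zero) +ℤ ∑ (λ i → f′ i +ℤ g′ i) ∎
  where
  f′ g′ : Fin n → ℤ
  f′ i = f (suc i)
  g′ i = g (suc i)
  interchange : ∀ p q r s → (p +ℤ r) +ℤ (q +ℤ s) ≡ (p +ℤ q) +ℤ (r +ℤ s)
  interchange = solve-∀

∑-*ˡ : ∀ {n} (k : ℤ) (f : Fin n → ℤ) → ∑ (λ i → k *ℤ f i) ≡ k *ℤ ∑ f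
∑-*ˡ {zero}  k f = sym (ℤ.*-zeroʳ k)
∑-*ˡ {suc n} k f = begin
  k *ℤ f zero +ℤ ∑ (λ i → k *ℤ f (suc i)) ≡⟨ cong (k *ℤ f zero +ℤ_) (∑-*ˡ k (λ i → f (suc i))) ⟩
  k *ℤ f zero +ℤ k *ℤ ∑ (λ i → f (suc i)) ≡⟨ ℤ.*-distribˡ-+ k (f zero) _ ⟨
  k *ℤ ∑ f                                  ∎

∑-*ʳ : ∀ {n} (f : Fin n → ℤ) (k : ℤ) → ∑ (λ i → f i *ℤ k) ≡ ∑ f *ℤ k
∑-*ʳ f k = begin
  ∑ (λ i → f i *ℤ k) ≡⟨ ∑-cong (λ i → ℤ.*-comm (f i) k) ⟩
  ∑ (λ i → k *ℤ f i) ≡⟨ ∑-*ˡ k f ⟩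
  k *ℤ ∑ f           ≡⟨ ℤ.*-comm k (∑ f) ⟩
  ∑ f *ℤ k           ∎

∑-swap : ∀ {m n} (f : Fin m → Fin n → ℤ) →
         ∑ (λ i → ∑ (λ c → f i c)) ≡ ∑ (λ c → ∑ (λ i → f i c))
∑-swap {zero} {n} f = sym (∑-zero {n} (λ _ → refl))
∑-swap {suc m} f = begin
  ∑ (f zero) +ℤ ∑ (λ i → ∑ (f (suc i)))           ≡⟨ cong (∑ (f zero) +ℤ_) (∑-swap (λ i → f (suc i))) ⟩
  ∑ (f zero) +ℤ ∑ (λ c → ∑ (λ i → f (suc i) c))   ≡⟨ ∑-+ (f zero) _ ⟩
  ∑ (λ c → f zero c +ℤ ∑ (λ i → f (suc i) c))     ∎

-- Parity of a signed sum: flipping the sign of some terms of ∑ e changes it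
-- by an even amount.  Concretely  dot e x = ∑ e - 2Y  for some Y.
dot-signs : ∀ {n} (e x : Fin n → ℤ) → (∀ i → (x i ≡ 1ℤ) ⊎ (x i ≡ -1ℤ)) →
            ∃ λ Y → dot e x ≡ ∑ e -ℤ (Y +ℤ Y)
dot-signs {zero}  e x sign = 0ℤ , refl
dot-signs {suc n} e x sign
  with dot-signs (λ i → e (suc i)) (λ i → x (suc i)) (λ i → sign (suc i)) | sign zero
... | Y , eq | inj₁ x₀≡1 =
  Y , trans (cong₂ _+ℤ_ (cong (e zero *ℤ_) x₀≡1) eq) (keep (e zero) _ Y)
  where
  keep : ∀ p s y → p *ℤ 1ℤ +ℤ (s -ℤ (y +ℤ y)) ≡ (p +ℤ s) -ℤ (y +ℤ y)
  keep = solve-∀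
... | Y , eq | inj₂ x₀≡-1 =
  e zero +ℤ Y , trans (cong₂ _+ℤ_ (cong (e zero *ℤ_) x₀≡-1) eq) (flip (e zero) _ Y)
  where
  flip : ∀ p s y → p *ℤ -1ℤ +ℤ (s -ℤ (y +ℤ y)) ≡ (p +ℤ s) -ℤ ((p +ℤ y) +ℤ (p +ℤ y))
  flip = solve-∀

sumRange : ℕ → (ℕ → ℤ) → ℤ
sumRange zero    h = 0ℤ
sumRange (suc n) h = h 0 +ℤ sumRange n (λ k → h (suc k))

∑-toℕ : ∀ n (h : ℕ → ℤ) → ∑ {n} (λ c → h (toℕ c)) ≡ sumRange n h
∑-toℕ zero    h = refl
∑-toℕ (suc n) h = cong (h 0 +ℤ_) (∑-toℕ n (λ k → h (suc k)))

sumRange-cong : ∀ n {f g : ℕ → ℤ} → (∀ k → f k ≡ g k) → sumRange n f ≡ sumRange n g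
sumRange-cong zero    p = refl
sumRange-cong (suc n) p = cong₂ _+ℤ_ (p 0) (sumRange-cong n (λ k → p (suc k)))

δ₀ : ℕ → ℤ
δ₀ zero    = 1ℤ
δ₀ (suc _) = 0ℤ

count-multiples-of-4 : ∀ a → sumRange (4 * a) (λ k → δ₀ (k % 4)) ≡ + a
count-multiples-of-4 zero    = refl
count-multiples-of-4 (suc a) = begin
  sumRange (4 * suc a) h             ≡⟨ cong (λ m → sumRange m h) (*-suc 4 a) ⟩
  1ℤ +ℤ (0ℤ +ℤ (0ℤ +ℤ (0ℤ +ℤ sumRange (4 * a) (λ k → h (4 + k)))))
    ≡⟨ cong (λ s → 1ℤ +ℤ (0ℤ +ℤ (0ℤ +ℤ (0ℤ +ℤ s)))) (sumRange-cong (4 * a) periodic) ⟩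
  1ℤ +ℤ (0ℤ +ℤ (0ℤ +ℤ (0ℤ +ℤ sumRange (4 * a) h)))
    ≡⟨ cong (λ s → 1ℤ +ℤ (0ℤ +ℤ (0ℤ +ℤ (0ℤ +ℤ s)))) (count-multiples-of-4 a) ⟩
  + suc a                            ∎
  where
  h : ℕ → ℤ
  h k = δ₀ (k % 4)
  periodic : ∀ k → h (4 + k) ≡ h k
  periodic k = cong δ₀ (trans (cong (_% 4) (+-comm 4 k)) ([m+n]%n≡m%n k 4))

colSum : ∀ {m n} → Matrix m n → Fin n → ℤ
colSum M c = ∑ (λ i → M i c)

∑-dot-rows : ∀ {m n} (M : Matrix m n) (x : Fin n → ℤ) →
             ∑ (λ i → dot (M i) x) ≡ dot (colSum M) x
∑-dot-rows M x = begin
  ∑ (λ i → ∑ (λ c → M i c *ℤ x c)) ≡⟨ ∑-swap (λ i c → M i c *ℤ x c) ⟩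
  ∑ (λ c → ∑ (λ i → M i c *ℤ x c)) ≡⟨ ∑-cong (λ c → ∑-*ʳ (λ i → M i c) (x c)) ⟩
  dot (colSum M) x                 ∎

colSum-W4 : ∀ j → colSum W4 j ≡ + 4 *ℤ δ₀ (toℕ j)
colSum-W4 zero                   = refl
colSum-W4 (suc zero)             = refl
colSum-W4 (suc (suc zero))       = refl
colSum-W4 (suc (suc (suc zero))) = refl

Hab-column : ∀ a (c : Fin (4 * a)) i → Hab a i c ≡ W4 i (toℕ c mod 4)
Hab-column a c i with toℕ c <ᵇ 4 * a | <⇒<ᵇ (toℕ<n c)
... | true  | _ = refl
... | false | ()

colSum-Hab : ∀ a (c : Fin (4 * a)) → colSum (Hab a {4 * a}) c ≡ + 4 *ℤ δ₀ (toℕ c % 4)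
colSum-Hab a c = begin
  colSum (Hab a) c            ≡⟨ ∑-cong (Hab-column a c) ⟩
  colSum W4 (toℕ c mod 4)     ≡⟨ colSum-W4 (toℕ c mod 4) ⟩
  + 4 *ℤ δ₀ (toℕ (toℕ c mod 4)) ≡⟨ cong (λ k → + 4 *ℤ δ₀ k) (toℕ-fromℕ< (m%n<n (toℕ c) 4)) ⟩
  + 4 *ℤ δ₀ (toℕ c % 4)       ∎

double⇒even : ∀ a (Y : ℤ) → + a ≡ Y +ℤ Y → 2 ∣ a
double⇒even a (+ m)    a≡2m = divides m (trans (ℤ.+-injective a≡2m) (double m))
  where
  double : ∀ m → m + m ≡ m * 2
  double = ℕ-Solver.solve-∀
double⇒even a -[1+ m ] ()

completion⇒even : ∀ a (x : Fin (4 * a) → ℤ) →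
                  IsPartialHadamard (appendRow (Hab a {4 * a}) x) → 2 ∣ a
completion⇒even a x (entries , orthogonal) = double⇒even a Y a≡2Y
  where
  H : Matrix 4 (4 * a)
  H = Hab a
  e : Fin (4 * a) → ℤ
  e c = δ₀ (toℕ c % 4)

  x⊥H : ∀ i → dot (H i) x ≡ 0ℤ
  x⊥H zero                   = orthogonal zero (suc (suc (suc (suc zero)))) λ ()
  x⊥H (suc zero)             = orthogonal (suc zero) (suc (suc (suc (suc zero)))) λ ()
  x⊥H (suc (suc zero))       = orthogonal (suc (suc zero)) (suc (suc (suc (suc zero)))) λ ()
  x⊥H (suc (suc (suc zero))) = orthogonal (suc (suc (suc zero))) (suc (suc (suc (suc zero)))) λ ()

  4·e·x≡0 : + 4 *ℤ dot e x ≡ + 4 *ℤ 0ℤ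
  4·e·x≡0 = begin
    + 4 *ℤ dot e x                 ≡⟨ ∑-*ˡ (+ 4) (λ c → e c *ℤ x c) ⟨
    ∑ (λ c → + 4 *ℤ (e c *ℤ x c))  ≡⟨ ∑-cong (λ c → ℤ.*-assoc (+ 4) (e c) (x c)) ⟨
    dot (λ c → + 4 *ℤ e c) x       ≡⟨ ∑-cong (λ c → cong (_*ℤ x c) (colSum-Hab a c)) ⟨
    dot (colSum H) x               ≡⟨ ∑-dot-rows H x ⟨
    ∑ (λ i → dot (H i) x)          ≡⟨ ∑-zero x⊥H ⟩
    0ℤ                             ∎

  signs : ∃ λ Y → dot e x ≡ ∑ e -ℤ (Y +ℤ Y)
  signs = dot-signs e x (entries (suc (suc (suc (suc zero)))))
  Y : ℤ
  Y = proj₁ signs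

  a≡2Y : + a ≡ Y +ℤ Y
  a≡2Y = ℤ.i-j≡0⇒i≡j (+ a) (Y +ℤ Y) (begin
    + a -ℤ (Y +ℤ Y)   ≡⟨ cong (_-ℤ (Y +ℤ Y)) (trans (∑-toℕ (4 * a) (λ k → δ₀ (k % 4))) (count-multiples-of-4 a)) ⟨
    ∑ e -ℤ (Y +ℤ Y)   ≡⟨ proj₂ signs ⟨
    dot e x           ≡⟨ ℤ.*-cancelˡ-≡ (+ 4) (dot e x) 0ℤ 4·e·x≡0 ⟩
    0ℤ                ∎)

product-zero⇒smaller-zero : ∀ a b → a ≥ b → a * b ≡ 0 → b ≡ 0
product-zero⇒smaller-zero a       zero    _         _ = refl
product-zero⇒smaller-zero (suc a) (suc b) (s≤s _) ()

completion⇒8∣4a : ∀ a N → N ≡ 4 * a →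
                  ∃ (λ (x : Fin N → ℤ) → IsPartialHadamard (appendRow (Hab a {N}) x)) →
                  8 ∣ N
completion⇒8∣4a a .(4 * a) refl (x , hadamard) = *-monoʳ-∣ 4 (completion⇒even a x hadamard)

completion⇒8∣N : (a b N : ℕ) → a ≥ b → N ≡ 4 * (a + b) →
                 ∃ (λ (x : Fin N → ℤ) → IsPartialHadamard (appendRow (Hab a {N}) x)) →
                 a * b ≡ 0 → 8 ∣ N
completion⇒8∣N a b N a≥b N≡4[a+b] completion ab≡0 = completion⇒8∣4a a N N≡4a completion
  where
  N≡4a : N ≡ 4 * a
  N≡4a = begin
    N           ≡⟨ N≡4[a+b] ⟩
    4 * (a + b) ≡⟨ cong (λ b′ → 4 * (a + b′)) (product-zero⇒smaller-zero a b a≥b ab≡0) ⟩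
    4 * (a + 0) ≡⟨ cong (4 *_) (+-identityʳ a) ⟩
    4 * a       ∎

theorem4p9 : ((a b N : ℕ) → a ≥ b → N ≡ 4 * (a + b) →
    ∃ (λ (x : Fin N → ℤ) → IsPartialHadamard (appendRow (Hab a {N}) x)) →
    a * b ≡ 0 → 8 ∣ N)
    ×
    ¬ ∃ (λ (x : Fin 12 → ℤ) → IsPartialHadamard (appendRow (Hab 3 {12}) x))
theorem4p9 =
  completion⇒8∣N ,
  λ completion → toWitnessFalse {a? = 8 ∣? 12} _ (completion⇒8∣N 3 0 12 z≤n refl completion refl)
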